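{- Let $r\ge1$. For $j\ge 0$, $k\ge 1$ and $n\ge 0$, the number of overpartitions $\pi$ of $n$ such that $mes(\pi;r)=k$ and exactly $j$ parts of $\pi$ have size greater than $k$ equals the number of overpartitions $\lambda$ of $n$ such that the largest $(r+1)$-repeating size of $\lambda$ is $j$ and exactly $k-1$ parts of $\lambda$ have size greater than $j$.
   Context: An overpartition of $n$ is a partition of $n$ in which the last occurrence of each distinct part value may be overlined. A part equal to $t$ or $\overline t$ has size $t$. For an overpartition $\pi$, $mes(\pi;r)$ is the smallest positive integer $t$ such that $\pi$ has no parts of size $t,t+1,\ldots,t+r-1$. A positive integer $j$ is an $(r+1)$-repeating size of $\pi$ if $\pi$ has at least $r+1$ parts of size $j$; by convention $0$ is always an $(r+1)$-repeating size of $\pi$. -}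

module Defs where

open import Data.Nat using (ℕ; zero; suc; _+_; _≤_; _<_; _<?_; _≟_)
open import Data.Bool using (Bool; true; false)
open import Data.Product using (_×_; _,_; proj₁; proj₂)
open import Data.Sum using (_⊎_)
open import Data.List using (List; length; filter; map)
open import Data.Nat.ListAction using (sum)
open import Data.List.Relation.Unary.All using (All)
open import Data.List.Relation.Unary.Any using (Any)
open import Data.List.Relation.Unary.Linked using (Linked)
open import Relation.Binary.PropositionalEquality using (_≡_)
open import Relation.Nullary using (¬_)

-- A part of an overpartition: (size, overlined?).
Part : Set
Part = ℕ × Bool

size : Part → ℕ
size = proj₁

-- Canonical listing of an overpartition: parts in non-increasing order of
-- size; among parts of equal size the (unique, optional) overlined copy is
-- listed first; a size can carry at most one overlined part.
-- p ▷ q : part p may be immediately followed by part q.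
data _▷_ : Part → Part → Set where
  bigger  : ∀ {s b s' b'} → s' < s → (s , b) ▷ (s' , b')
  ovl     : ∀ {s} → (s , true) ▷ (s , false)
  plain   : ∀ {s} → (s , false) ▷ (s , false)

IsOverpartition : List Part → Set
IsOverpartition π = All (λ p → 1 ≤ size p) π × Linked _▷_ π

weight : List Part → ℕ
weight π = sum (map size π)

IsOverpartitionOf : ℕ → List Part → Set
IsOverpartitionOf n π = IsOverpartition π × weight π ≡ n

HasPartOfSize : ℕ → List Part → Set
HasPartOfSize t π = Any (λ p → size p ≡ t) π

mult : ℕ → List Part → ℕ
mult t π = length (filter (λ p → size p ≟ t) π)

partsAbove : ℕ → List Part → ℕ
partsAbove k π = length (filter (λ p → k <? size p) π)

NoPartsIn : ℕ → List Part → ℕ → Set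
NoPartsIn r π t = ∀ i → i < r → ¬ HasPartOfSize (t + i) π

IsMes : ℕ → List Part → ℕ → Set
IsMes r π k = 1 ≤ k × NoPartsIn r π k × (∀ t → 1 ≤ t → t < k → ¬ NoPartsIn r π t)

IsRepeating : ℕ → List Part → ℕ → Set
IsRepeating r π j = j ≡ 0 ⊎ (1 ≤ j × suc r ≤ mult j π)

IsLargestRepeating : ℕ → List Part → ℕ → Set
IsLargestRepeating r π j = IsRepeating r π j × (∀ t → IsRepeating r π t → t ≤ j)

-- Conjugating the Ferrers diagram of an overpartition, each overline riding along on the
-- corner it marks, is an involution preserving n. List an overpartition as its runs of equal
-- parts, largest first, each run recording its multiplicity and its gap down to the next size;
-- conjugation reverses the runs and swaps gap and multiplicity in each of them.
-- Let the largest run of μ have size S, gap g + 1 and multiplicity m + 1. In the conjugate π it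
-- becomes the g + 1 smallest parts, of size m + 1, and every other part of π is raised by m + 1.
-- If m + 1 > r, then S is the largest (r+1)-repeating size of μ with no part above it, while
-- every part of π exceeds r, so mes(π;r) = 1 and all S parts of π lie above it. If m + 1 ≤ r,
-- the largest repeating size of μ is that of the remaining runs and gains m + 1 parts above it,
-- while the parts of size m + 1 block every t ≤ m + 1, so mes(π;r) grows by m + 1 and the count
-- of parts above it is unchanged.

module Submission where

open import Defs
open import Data.Bool using (Bool; true; false)
import Data.Bool as Bool
open import Data.List using (List; []; _∷_; _++_; _∷ʳ_; length; filter; replicate; map; reverse; foldr)
open import Data.List.Properties
  using (length-++; length-replicate; filter-++; filter-all; filter-none; filter-accept; filter-reject; map-++; map-replicate;
         map-cong; map-id; map-∘; ++-assoc; ++-identityʳ; reverse-map; reverse-involutive; unfold-reverse; ≡-dec)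
open import Data.List.Relation.Unary.All as All using (All; []; _∷_)
import Data.List.Relation.Unary.All.Properties as Allₚ
open import Data.List.Relation.Unary.Any as Any using (here)
import Data.List.Relation.Unary.Any.Properties as Anyₚ
open import Data.List.Relation.Unary.Linked using (Linked; []; [-]; _∷_)
import Data.List.Relation.Unary.Linked as Linked
open import Data.Nat using (ℕ; zero; suc; _+_; _*_; _∸_; _≤_; _<_; _<?_; _≟_; z≤n; s≤s)
open import Data.Nat.Properties
open import Data.Nat.ListAction using (sum)
open import Data.Nat.ListAction.Properties using (sum-++)
open import Data.Nat.Tactic.RingSolver using (solve-∀)
open import Data.Product using (_×_; _,_; proj₁; ∃-syntax; map₂)
import Data.Product.Properties as Productₚ
open import Data.Sum using (_⊎_; inj₁; inj₂)
import Data.Sum as Sum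
open import Data.Refinement using (Refinement-syntax; _,_; value; value-injective)
open import Data.Irrelevant using ([_])
import Data.Refinement as Refinement
open import Function.Base using (_∘_)
open import Function.Bundles using (_↔_; _⇔_; mk↔ₛ′; mk⇔; Equivalence)
open import Level using (0ℓ)
open import Relation.Binary.PropositionalEquality
open import Relation.Nullary using (¬_; yes; no; contradiction; recompute)
open import Relation.Unary using (Pred; Decidable; ∁)

-- Counting parts

module _ {A : Set} {P : Pred A 0ℓ} (P? : Decidable P) where

  count-++ : ∀ xs ys → length (filter P? (xs ++ ys)) ≡ length (filter P? xs) + length (filter P? ys)
  count-++ xs ys = trans (cong length (filter-++ P? xs ys)) (length-++ (filter P? xs))

  count-all : ∀ {xs} → All P xs → length (filter P? xs) ≡ length xs
  count-all = cong length ∘ filter-all P?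

  count-none : ∀ {xs} → All (∁ P) xs → length (filter P? xs) ≡ 0
  count-none = cong length ∘ filter-none P?

mult-++ : ∀ t xs ys → mult t (xs ++ ys) ≡ mult t xs + mult t ys
mult-++ t = count-++ (λ p → size p ≟ t)

partsAbove-++ : ∀ k xs ys → partsAbove k (xs ++ ys) ≡ partsAbove k xs + partsAbove k ys
partsAbove-++ k = count-++ (λ p → k <? size p)

partsAbove-all : ∀ {k xs} → All (λ p → k < size p) xs → partsAbove k xs ≡ length xs
partsAbove-all {k} = count-all (λ p → k <? size p)

partsAbove-none : ∀ {k xs} → All (λ p → size p ≤ k) xs → partsAbove k xs ≡ 0
partsAbove-none {k} = count-none (λ p → k <? size p) ∘ All.map ≤⇒≯

partsAbove-accept : ∀ {k p xs} → k < size p → partsAbove k (p ∷ xs) ≡ suc (partsAbove k xs)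
partsAbove-accept {k} = cong length ∘ filter-accept (λ p → k <? size p)

partsAbove-reject : ∀ {k p xs} → ¬ k < size p → partsAbove k (p ∷ xs) ≡ partsAbove k xs
partsAbove-reject {k} = cong length ∘ filter-reject (λ p → k <? size p)

mult-absent : ∀ {S t xs} → All (λ p → size p < S) xs → S ≤ t → mult t xs ≡ 0
mult-absent {S} {t} xs<S S≤t =
  count-none (λ p → size p ≟ t) (All.map (λ s<S s≡t → <⇒≱ s<S (subst (S ≤_) (sym s≡t) S≤t)) xs<S)

size-lookup : ∀ {P : ℕ → Set} {t xs} → All (P ∘ size) xs → HasPartOfSize t xs → P t
size-lookup {P} = All.lookupWith (λ Ps s≡t → subst P s≡t Ps)

weight-++ : ∀ xs ys → weight (xs ++ ys) ≡ weight xs + weight ys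
weight-++ xs ys = trans (cong sum (map-++ size xs ys)) (sum-++ (map size xs) _)

-- Runs and shifts

run : ℕ → ℕ → Bool → List Part
run s m b = (s , b) ∷ replicate m (s , false)

run-sizes : ∀ {P : ℕ → Set} {s} m b → P s → All (P ∘ size) (run s m b)
run-sizes m b Ps = Ps ∷ Allₚ.replicate⁺ m Ps

run-size : ∀ {t s m b} → HasPartOfSize t (run s m b) → t ≡ s
run-size {m = m} {b} h = sym (size-lookup (run-sizes {_ ≡_} m b refl) h)

length-run : ∀ s m b → length (run s m b) ≡ suc m
length-run s m b = cong suc (length-replicate m)

weight-run : ∀ s m b → weight (run s m b) ≡ suc m * s
weight-run s zero b = refl
weight-run s (suc m) b = cong (s +_) (weight-run s m false)

▷-same : ∀ s b → (s , b) ▷ (s , false)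
▷-same s true = ovl
▷-same s false = plain

run-++-linked : ∀ {s} m b {ys} → Linked _▷_ ys → All (λ p → size p < s) ys → Linked _▷_ (run s m b ++ ys)
run-++-linked zero b [] [] = [-]
run-++-linked zero b ys-linked (y<s ∷ _) = bigger y<s ∷ ys-linked
run-++-linked (suc m) b ys-linked ys<s = ▷-same _ b ∷ run-++-linked m false ys-linked ys<s

raise : ℕ → Part → Part
raise G (s , b) = (G + s , b)

shift : ℕ → List Part → List Part
shift G = map (raise G)

shift-run : ∀ G s m b → shift G (run s m b) ≡ run (G + s) m b
shift-run G s m b = cong ((G + s , b) ∷_) (map-replicate (raise G) m (s , false))

weight-shift : ∀ G xs → weight (shift G xs) ≡ G * length xs + weight xs
weight-shift G [] = sym (cong (_+ 0) (*-zeroʳ G))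
weight-shift G ((s , b) ∷ xs) = trans (cong ((G + s) +_) (weight-shift G xs)) (distrib G s (length xs) (weight xs))
  where
  distrib : ∀ G s l w → (G + s) + (G * l + w) ≡ G * suc l + (s + w)
  distrib = solve-∀

hasPart-shift : ∀ G u xs → HasPartOfSize (G + u) (shift G xs) ⇔ HasPartOfSize u xs
hasPart-shift G u xs =
  mk⇔ (Any.map (+-cancelˡ-≡ G _ _) ∘ Anyₚ.map⁻) (Anyₚ.map⁺ ∘ Any.map (cong (G +_)))

shift-sizes : ∀ G xs → All (λ p → G ≤ size p) (shift G xs)
shift-sizes G xs = Allₚ.map⁺ (All.universal (λ p → m≤m+n G (size p)) xs)

partsAbove-shift : ∀ G k xs → partsAbove (G + k) (shift G xs) ≡ partsAbove k xs
partsAbove-shift G k [] = refl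
partsAbove-shift G k ((s , b) ∷ xs) with k <? s
... | yes k<s = trans (partsAbove-accept (+-monoʳ-< G k<s))
                      (trans (cong suc (partsAbove-shift G k xs)) (sym (partsAbove-accept k<s)))
... | no k≮s = trans (partsAbove-reject (k≮s ∘ +-cancelˡ-< G k s))
                     (trans (partsAbove-shift G k xs) (sym (partsAbove-reject k≮s)))

-- Run encoding and conjugation

-- A run (g , m , b) stands for suc m parts of one size, the first of them overlined iff b,
-- whose size exceeds the next smaller size of the list (or 0) by suc g.
Run : Set
Run = ℕ × ℕ × Bool

height : List Run → ℕ
height [] = 0
height ((g , _ , _) ∷ R) = suc g + height R

width : List Run → ℕ
width [] = 0
width ((_ , m , _) ∷ R) = suc m + width R

toParts : List Run → List Part
toParts [] = []
toParts ((g , m , b) ∷ R) = run (suc g + height R) m b ++ toParts R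

transpose : Run → Run
transpose (g , m , b) = (m , g , b)

conjugateRuns : List Run → List Run
conjugateRuns = reverse ∘ map transpose

conjugateRuns-∷ : ∀ c R → conjugateRuns (c ∷ R) ≡ conjugateRuns R ∷ʳ transpose c
conjugateRuns-∷ c R = unfold-reverse (transpose c) (map transpose R)

conjugateRuns-involutive : ∀ R → conjugateRuns (conjugateRuns R) ≡ R
conjugateRuns-involutive R = begin
  reverse (map transpose (reverse (map transpose R))) ≡⟨ cong reverse (reverse-map transpose (map transpose R)) ⟩
  reverse (reverse (map transpose (map transpose R))) ≡⟨ reverse-involutive _ ⟩
  map transpose (map transpose R)                     ≡⟨ map-∘ R ⟨
  map (transpose ∘ transpose) R                       ≡⟨ map-cong (λ _ → refl) R ⟩
  map (λ x → x) R                                     ≡⟨ map-id R ⟩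
  R                                                   ∎
  where open ≡-Reasoning

height-∷ʳ : ∀ R g m b → height (R ∷ʳ (g , m , b)) ≡ height R + suc g
height-∷ʳ [] g m b = +-identityʳ (suc g)
height-∷ʳ ((g′ , _ , _) ∷ R) g m b = trans (cong (suc g′ +_) (height-∷ʳ R g m b)) (sym (+-assoc (suc g′) (height R) (suc g)))

width-∷ʳ : ∀ R g m b → width (R ∷ʳ (g , m , b)) ≡ width R + suc m
width-∷ʳ [] g m b = +-identityʳ (suc m)
width-∷ʳ ((_ , m′ , _) ∷ R) g m b = trans (cong (suc m′ +_) (width-∷ʳ R g m b)) (sym (+-assoc (suc m′) (width R) (suc m)))

width-conjugateRuns : ∀ R → width (conjugateRuns R) ≡ height R
width-conjugateRuns [] = refl
width-conjugateRuns ((g , m , b) ∷ R) = begin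
  width (conjugateRuns ((g , m , b) ∷ R))  ≡⟨ cong width (conjugateRuns-∷ (g , m , b) R) ⟩
  width (conjugateRuns R ∷ʳ (m , g , b))   ≡⟨ width-∷ʳ (conjugateRuns R) m g b ⟩
  width (conjugateRuns R) + suc g          ≡⟨ cong (_+ suc g) (width-conjugateRuns R) ⟩
  height R + suc g                         ≡⟨ +-comm (height R) (suc g) ⟩
  suc g + height R                         ∎
  where open ≡-Reasoning

length-toParts : ∀ R → length (toParts R) ≡ width R
length-toParts [] = refl
length-toParts ((g , m , b) ∷ R) =
  trans (length-++ (run _ m b)) (cong₂ _+_ (length-run _ m b) (length-toParts R))

toParts-∷ʳ : ∀ R g m b → toParts (R ∷ʳ (g , m , b)) ≡ shift (suc g) (toParts R) ++ run (suc g) m b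
toParts-∷ʳ [] g m b = trans (++-identityʳ _) (cong (λ s → run s m b) (+-identityʳ (suc g)))
toParts-∷ʳ ((g′ , m′ , b′) ∷ R) g m b = begin
  run (suc g′ + height (R ∷ʳ (g , m , b))) m′ b′ ++ toParts (R ∷ʳ (g , m , b))
    ≡⟨ cong₂ _++_ (cong (λ s → run s m′ b′) top) (toParts-∷ʳ R g m b) ⟩
  run (suc g + (suc g′ + height R)) m′ b′ ++ (shift (suc g) (toParts R) ++ run (suc g) m b)
    ≡⟨ ++-assoc (run _ m′ b′) _ _ ⟨
  (run (suc g + (suc g′ + height R)) m′ b′ ++ shift (suc g) (toParts R)) ++ run (suc g) m b
    ≡⟨ cong (λ xs → (xs ++ shift (suc g) (toParts R)) ++ run (suc g) m b) (shift-run (suc g) _ m′ b′) ⟨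
  (shift (suc g) (run (suc g′ + height R) m′ b′) ++ shift (suc g) (toParts R)) ++ run (suc g) m b
    ≡⟨ cong (_++ run (suc g) m b) (map-++ (raise (suc g)) (run _ m′ b′) (toParts R)) ⟨
  shift (suc g) (toParts ((g′ , m′ , b′) ∷ R)) ++ run (suc g) m b
    ∎
  where
  open ≡-Reasoning
  top : suc g′ + height (R ∷ʳ (g , m , b)) ≡ suc g + (suc g′ + height R)
  top = trans (cong (suc g′ +_) (height-∷ʳ R g m b))
              (trans (sym (+-assoc (suc g′) (height R) (suc g))) (+-comm (suc g′ + height R) (suc g)))

toParts-conjugateRuns-∷ : ∀ g m b R →
  toParts (conjugateRuns ((g , m , b) ∷ R)) ≡ shift (suc m) (toParts (conjugateRuns R)) ++ run (suc m) g b
toParts-conjugateRuns-∷ g m b R =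
  trans (cong toParts (conjugateRuns-∷ (g , m , b) R)) (toParts-∷ʳ (conjugateRuns R) m g b)

weight-toParts-conjugateRuns : ∀ R → weight (toParts (conjugateRuns R)) ≡ weight (toParts R)
weight-toParts-conjugateRuns [] = refl
weight-toParts-conjugateRuns ((g , m , b) ∷ R) = begin
  weight (toParts (conjugateRuns ((g , m , b) ∷ R)))
    ≡⟨ cong weight (toParts-conjugateRuns-∷ g m b R) ⟩
  weight (shift (suc m) π′ ++ run (suc m) g b)
    ≡⟨ weight-++ (shift (suc m) π′) _ ⟩
  weight (shift (suc m) π′) + weight (run (suc m) g b)
    ≡⟨ cong₂ _+_ (weight-shift (suc m) π′) (weight-run (suc m) g b) ⟩
  (suc m * length π′ + weight π′) + suc g * suc m
    ≡⟨ cong₂ (λ l w → (suc m * l + w) + suc g * suc m) length-π′ (weight-toParts-conjugateRuns R) ⟩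
  (suc m * height R + weight (toParts R)) + suc g * suc m
    ≡⟨ regroup m g (height R) (weight (toParts R)) ⟩
  suc m * (suc g + height R) + weight (toParts R)
    ≡⟨ cong (_+ weight (toParts R)) (weight-run (suc g + height R) m b) ⟨
  weight (run (suc g + height R) m b) + weight (toParts R)
    ≡⟨ weight-++ (run _ m b) (toParts R) ⟨
  weight (toParts ((g , m , b) ∷ R))
    ∎
  where
  open ≡-Reasoning
  π′ = toParts (conjugateRuns R)
  length-π′ : length π′ ≡ height R
  length-π′ = trans (length-toParts (conjugateRuns R)) (width-conjugateRuns R)
  regroup : ∀ m g h w → (suc m * h + w) + suc g * suc m ≡ suc m * (suc g + h) + w
  regroup = solve-∀

toParts-positive : ∀ R → All (λ p → 1 ≤ size p) (toParts R)
toParts-positive [] = []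
toParts-positive ((g , m , b) ∷ R) = Allₚ.++⁺ (run-sizes m b (s≤s z≤n)) (toParts-positive R)

toParts-bounded : ∀ R → All (λ p → size p ≤ height R) (toParts R)
toParts-bounded [] = []
toParts-bounded ((g , m , b) ∷ R) =
  Allₚ.++⁺ (run-sizes m b ≤-refl) (All.map (λ s≤h → ≤-trans s≤h (m≤n+m _ (suc g))) (toParts-bounded R))

toParts-below : ∀ g R → All (λ p → size p < suc g + height R) (toParts R)
toParts-below g R = All.map (λ s≤h → s≤s (≤-trans s≤h (m≤n+m _ g))) (toParts-bounded R)

toParts-isOverpartition : ∀ R → IsOverpartition (toParts R)
toParts-isOverpartition R = toParts-positive R , linked R
  where
  linked : ∀ R → Linked _▷_ (toParts R)
  linked [] = []
  linked ((g , m , b) ∷ R) = run-++-linked m b (linked R) (toParts-below g R)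

consPart : Part → List Run → List Run
consPart (s , b) [] = (s ∸ 1 , 0 , b) ∷ []
consPart (s , b) R@((g , m , _) ∷ R′) with s ≟ suc g + height R′
... | yes _ = (g , suc m , b) ∷ R′
... | no _ = (s ∸ suc (height R) , 0 , b) ∷ R

fromParts : List Part → List Run
fromParts = foldr consPart []

suc[m∸suc[n]]+n≡m : ∀ {h s} → h < s → suc (s ∸ suc h) + h ≡ s
suc[m∸suc[n]]+n≡m {h} {s} h<s = trans (sym (+-suc (s ∸ suc h) h)) (m∸n+n≡m h<s)

consPart-new : ∀ {s} b R → height R < s → consPart (s , b) R ≡ (s ∸ suc (height R) , 0 , b) ∷ R
consPart-new b [] h<s = refl
consPart-new {s} b ((g , m , _) ∷ R) h<s with s ≟ suc g + height R
... | yes s≡h = contradiction (sym s≡h) (<⇒≢ h<s)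
... | no _ = refl

consPart-top : ∀ {s} b g m b′ R → s ≡ suc g + height R → consPart (s , b) ((g , m , b′) ∷ R) ≡ (g , suc m , b) ∷ R
consPart-top {s} b g m b′ R s≡h with s ≟ suc g + height R
... | yes _ = refl
... | no s≢h = contradiction s≡h s≢h

fromParts-run-++ : ∀ {s} m b R → height R < s → fromParts (toParts R) ≡ R →
  fromParts (run s m b ++ toParts R) ≡ (s ∸ suc (height R) , m , b) ∷ R
fromParts-run-++ zero b R h<s R≡ = trans (cong (consPart (_ , b)) R≡) (consPart-new b R h<s)
fromParts-run-++ (suc m) b R h<s R≡ =
  trans (cong (consPart (_ , b)) (fromParts-run-++ m false R h<s R≡))
        (consPart-top b _ m false R (sym (suc[m∸suc[n]]+n≡m h<s)))

fromParts-toParts : ∀ R → fromParts (toParts R) ≡ R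
fromParts-toParts [] = refl
fromParts-toParts ((g , m , b) ∷ R) =
  trans (fromParts-run-++ m b R (s≤s (m≤n+m (height R) g)) (fromParts-toParts R))
        (cong (λ g → (g , m , b) ∷ R) (m+n∸n≡m g (height R)))

toParts-consPart-new : ∀ {s} b R → height R < s → toParts (consPart (s , b) R) ≡ (s , b) ∷ toParts R
toParts-consPart-new b R h<s =
  trans (cong toParts (consPart-new b R h<s)) (cong (λ s → (s , b) ∷ toParts R) (suc[m∸suc[n]]+n≡m h<s))

toParts-consPart : ∀ {s b} R → 1 ≤ s → Linked _▷_ ((s , b) ∷ toParts R) → toParts (consPart (s , b) R) ≡ (s , b) ∷ toParts R
toParts-consPart [] 1≤s _ = toParts-consPart-new _ [] 1≤s
toParts-consPart R@(_ ∷ _) _ (bigger h<s ∷ _) = toParts-consPart-new _ R h<s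
toParts-consPart ((g , m , false) ∷ R) _ (ovl ∷ _) = cong toParts (consPart-top true g m false R refl)
toParts-consPart ((g , m , false) ∷ R) _ (plain ∷ _) = cong toParts (consPart-top false g m false R refl)

toParts-fromParts : ∀ {π} → IsOverpartition π → toParts (fromParts π) ≡ π
toParts-fromParts {[]} _ = refl
toParts-fromParts {(s , b) ∷ π} (1≤s ∷ positive , linked) =
  trans (toParts-consPart (fromParts π) 1≤s (subst (λ xs → Linked _▷_ ((s , b) ∷ xs)) (sym ih) linked))
        (cong ((s , b) ∷_) ih)
  where
  ih : toParts (fromParts π) ≡ π
  ih = toParts-fromParts (positive , Linked.tail linked)

conjugate : List Part → List Part
conjugate = toParts ∘ conjugateRuns ∘ fromParts

conjugate-involutive : ∀ {π} → IsOverpartition π → conjugate (conjugate π) ≡ π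
conjugate-involutive {π} op = begin
  toParts (conjugateRuns (fromParts (toParts (conjugateRuns (fromParts π)))))
    ≡⟨ cong (toParts ∘ conjugateRuns) (fromParts-toParts (conjugateRuns (fromParts π))) ⟩
  toParts (conjugateRuns (conjugateRuns (fromParts π)))
    ≡⟨ cong toParts (conjugateRuns-involutive (fromParts π)) ⟩
  toParts (fromParts π)
    ≡⟨ toParts-fromParts op ⟩
  π ∎
  where open ≡-Reasoning

conjugate-isOverpartition : ∀ π → IsOverpartition (conjugate π)
conjugate-isOverpartition π = toParts-isOverpartition (conjugateRuns (fromParts π))

conjugate-overpartitionOf : ∀ {n π} → IsOverpartitionOf n π → IsOverpartitionOf n (conjugate π)
conjugate-overpartitionOf {π = π} (op , refl) =
  conjugate-isOverpartition π ,
  trans (weight-toParts-conjugateRuns (fromParts π)) (cong weight (toParts-fromParts op))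

≤⊎≡+suc : ∀ G t → t ≤ G ⊎ ∃[ a ] t ≡ G + suc a
≤⊎≡+suc _ zero = inj₁ z≤n
≤⊎≡+suc zero (suc t) = inj₂ (t , refl)
≤⊎≡+suc (suc G) (suc t) = Sum.map s≤s (map₂ (cong suc)) (≤⊎≡+suc G t)

-- mes and repeating sizes

isMes-unique : ∀ {r π k k′} → IsMes r π k → IsMes r π k′ → k ≡ k′
isMes-unique (1≤k , free , minimal) (1≤k′ , free′ , minimal′) =
  ≤-antisym (≮⇒≥ λ k′<k → minimal _ 1≤k′ k′<k free′) (≮⇒≥ λ k<k′ → minimal′ _ 1≤k k<k′ free)

isMes-large : ∀ {r π} → All (λ p → r < size p) π → IsMes r π 1
isMes-large π>r =
  s≤s z≤n ,
  (λ i i<r has → <⇒≱ i<r (≤-pred (size-lookup π>r has))) ,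
  λ { t 1≤t (s≤s t≤0) _ → <⇒≱ 1≤t t≤0 }

module BottomRun (G m : ℕ) (b : Bool) (π′ : List Part) where

  π : List Part
  π = shift G π′ ++ run G m b

  hasPart-above : ∀ a → HasPartOfSize (G + suc a) π ⇔ HasPartOfSize (suc a) π′
  hasPart-above a = mk⇔ to (Anyₚ.++⁺ˡ ∘ Equivalence.from (hasPart-shift G (suc a) π′))
    where
    to : HasPartOfSize (G + suc a) π → HasPartOfSize (suc a) π′
    to has with Anyₚ.++⁻ (shift G π′) has
    ... | inj₁ has′ = Equivalence.to (hasPart-shift G (suc a) π′) has′
    ... | inj₂ has′ = contradiction (run-size has′) (m+1+n≢m G)

  noPartsIn-above : ∀ {r} a → NoPartsIn r π (G + suc a) ⇔ NoPartsIn r π′ (suc a)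
  noPartsIn-above a = mk⇔
    (λ free i i<r has′ → free i i<r (subst (λ t → HasPartOfSize t π) (sym (+-assoc G (suc a) i))
                                           (Equivalence.from (hasPart-above (a + i)) has′)))
    (λ free′ i i<r has → free′ i i<r (Equivalence.to (hasPart-above (a + i))
                                        (subst (λ t → HasPartOfSize t π) (+-assoc G (suc a) i) has)))

  occupied : ∀ {r t} → G ≤ r → 1 ≤ t → t ≤ G → ¬ NoPartsIn r π t
  occupied {t = t} G≤r 1≤t t≤G free =
    free (G ∸ t) (<-≤-trans (subst (G ∸ t <_) (m+[n∸m]≡n t≤G) (m<n+m (G ∸ t) 1≤t)) G≤r)
         (subst (λ u → HasPartOfSize u π) (sym (m+[n∸m]≡n t≤G)) (Anyₚ.++⁺ʳ (shift G π′) (here refl)))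

  isMes-bottom⁺ : ∀ {r k} → G ≤ r → IsMes r π′ k → IsMes r π (G + k)
  isMes-bottom⁺ {r} {suc a} G≤r (_ , free′ , minimal′) =
    ≤-trans (s≤s z≤n) (m≤n+m (suc a) G) , Equivalence.from (noPartsIn-above a) free′ , minimal
    where
    minimal : ∀ t → 1 ≤ t → t < G + suc a → ¬ NoPartsIn r π t
    minimal t 1≤t t< free with ≤⊎≡+suc G t
    ... | inj₁ t≤G = occupied G≤r 1≤t t≤G free
    ... | inj₂ (c , refl) =
      minimal′ (suc c) (s≤s z≤n) (+-cancelˡ-< G _ _ t<) (Equivalence.to (noPartsIn-above c) free)

  isMes-bottom⁻ : ∀ {r k} → G ≤ r → IsMes r π k → ∃[ a ] k ≡ G + suc a × IsMes r π′ (suc a)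
  isMes-bottom⁻ {r} {k} G≤r (1≤k , free , minimal) with ≤⊎≡+suc G k
  ... | inj₁ k≤G = contradiction free (occupied G≤r 1≤k k≤G)
  ... | inj₂ (a , refl) = a , refl , s≤s z≤n , Equivalence.to (noPartsIn-above a) free , minimal′
    where
    minimal′ : ∀ t → 1 ≤ t → t < suc a → ¬ NoPartsIn r π′ t
    minimal′ (suc c) _ t< free′ =
      minimal (G + suc c) (≤-trans (s≤s z≤n) (m≤n+m (suc c) G)) (+-monoʳ-< G t<)
              (Equivalence.from (noPartsIn-above c) free′)

  partsAbove-bottom : ∀ k → partsAbove (G + k) π ≡ partsAbove k π′
  partsAbove-bottom k = begin
    partsAbove (G + k) π                                              ≡⟨ partsAbove-++ (G + k) (shift G π′) _ ⟩
    partsAbove (G + k) (shift G π′) + partsAbove (G + k) (run G m b)  ≡⟨ cong₂ _+_ (partsAbove-shift G k π′)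
                                                                                  (partsAbove-none (run-sizes m b (m≤m+n G k))) ⟩
    partsAbove k π′ + 0                                               ≡⟨ +-identityʳ _ ⟩
    partsAbove k π′                                                   ∎
    where open ≡-Reasoning

  bottom-large : ∀ {r} → r < G → All (λ p → r < size p) π
  bottom-large r<G = Allₚ.++⁺ (All.map (<-≤-trans r<G) (shift-sizes G π′)) (run-sizes m b r<G)

isLargestRepeating-unique : ∀ {r xs j j′} → IsLargestRepeating r xs j → IsLargestRepeating r xs j′ → j ≡ j′
isLargestRepeating-unique (rep , max) (rep′ , max′) = ≤-antisym (max′ _ rep) (max _ rep′)

isLargestRepeating-cong : ∀ {r xs ys} → (∀ t → IsRepeating r xs t ⇔ IsRepeating r ys t) →
  ∀ {j} → IsLargestRepeating r xs j ⇔ IsLargestRepeating r ys j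
isLargestRepeating-cong same {j} = mk⇔
  (λ (rep , max) → Equivalence.to (same j) rep , λ t rep′ → max t (Equivalence.from (same t) rep′))
  (λ (rep′ , max′) → Equivalence.from (same j) rep′ , λ t rep → max′ t (Equivalence.to (same t) rep))

repeating-bounded : ∀ {r S t xs} → 1 ≤ S → All (λ p → size p < S) xs → IsRepeating r xs t → t < S
repeating-bounded 1≤S _ (inj₁ refl) = 1≤S
repeating-bounded {S = S} {t} _ xs<S (inj₂ (_ , r<mult)) with t <? S
... | yes t<S = t<S
... | no t≮S = contradiction (subst (suc _ ≤_) (mult-absent xs<S (≮⇒≥ t≮S)) r<mult) λ ()

isLargestRepeating-[] : ∀ {r} → IsLargestRepeating r [] 0
isLargestRepeating-[] = inj₁ refl , λ t rep → ≤-pred (repeating-bounded (s≤s z≤n) [] rep)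

module TopRun (S m : ℕ) (b : Bool) {μ′ : List Part} (μ′<S : All (λ p → size p < S) μ′) where

  μ : List Part
  μ = run S m b ++ μ′

  μ<1+S : All (λ p → size p < suc S) μ
  μ<1+S = Allₚ.++⁺ (run-sizes m b ≤-refl) (All.map m<n⇒m<1+n μ′<S)

  mult-top : mult S μ ≡ suc m
  mult-top = begin
    mult S μ                        ≡⟨ mult-++ S (run S m b) μ′ ⟩
    mult S (run S m b) + mult S μ′  ≡⟨ cong₂ _+_ (count-all (λ p → size p ≟ S) (run-sizes {_≡ S} m b refl))
                                                 (mult-absent μ′<S ≤-refl) ⟩
    length (run S m b) + 0          ≡⟨ +-identityʳ _ ⟩
    length (run S m b)              ≡⟨ length-run S m b ⟩
    suc m                           ∎
    where open ≡-Reasoning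

  mult-other : ∀ {t} → t ≢ S → mult t μ ≡ mult t μ′
  mult-other {t} t≢S = trans (mult-++ t (run S m b) μ′)
    (cong (_+ mult t μ′) (count-none (λ p → size p ≟ t) (run-sizes {_≢ t} m b (t≢S ∘ sym))))

  partsAbove-top : partsAbove S μ ≡ 0
  partsAbove-top = partsAbove-none (All.map ≤-pred μ<1+S)

  partsAbove-below : ∀ {j} → j < S → partsAbove j μ ≡ suc m + partsAbove j μ′
  partsAbove-below {j} j<S = trans (partsAbove-++ j (run S m b) μ′)
    (cong (_+ partsAbove j μ′) (trans (partsAbove-all (run-sizes m b j<S)) (length-run S m b)))

  isLargestRepeating-top : ∀ {r} → 1 ≤ S → r ≤ m → IsLargestRepeating r μ S
  isLargestRepeating-top 1≤S r≤m =
    inj₂ (1≤S , subst (_ ≤_) (sym mult-top) (s≤s r≤m)) ,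
    λ t rep → ≤-pred (repeating-bounded (s≤s z≤n) μ<1+S rep)

  isRepeating-drop-top : ∀ {r} → m < r → ∀ t → IsRepeating r μ t ⇔ IsRepeating r μ′ t
  isRepeating-drop-top {r} m<r t = mk⇔ to from
    where
    to : IsRepeating r μ t → IsRepeating r μ′ t
    to (inj₁ t≡0) = inj₁ t≡0
    to (inj₂ (1≤t , r<mult)) with t ≟ S
    ... | yes t≡S = contradiction (subst (suc r ≤_) (trans (cong (λ u → mult u μ) t≡S) mult-top) r<mult) (<⇒≱ (s≤s m<r))
    ... | no t≢S = inj₂ (1≤t , subst (suc r ≤_) (mult-other t≢S) r<mult)
    from : IsRepeating r μ′ t → IsRepeating r μ t
    from (inj₁ t≡0) = inj₁ t≡0
    from (inj₂ (1≤t , r<mult)) =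
      inj₂ (1≤t , ≤-trans r<mult (subst (mult t μ′ ≤_) (sym (mult-++ t (run S m b) μ′)) (m≤n+m _ _)))

-- mes(π;r) is written suc k here, so the theorem's k ∸ 1 becomes k.
MesPair : ℕ → List Part → ℕ → ℕ → Set
MesPair r π k j = IsMes r π (suc k) × partsAbove (suc k) π ≡ j

RepeatingPair : ℕ → List Part → ℕ → ℕ → Set
RepeatingPair r μ j k = IsLargestRepeating r μ j × partsAbove j μ ≡ k

mes⇔repeating-[] : ∀ {r j k} → MesPair r [] k j ⇔ RepeatingPair r [] j k
mes⇔repeating-[] {r} = mk⇔ to from
  where
  to : ∀ {j k} → MesPair r [] k j → RepeatingPair r [] j k
  to (mes , refl) with isMes-unique mes (isMes-large [])
  ... | refl = isLargestRepeating-[] , refl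
  from : ∀ {j k} → RepeatingPair r [] j k → MesPair r [] k j
  from (lr , refl) with isLargestRepeating-unique {xs = []} lr isLargestRepeating-[]
  ... | refl = isMes-large [] , refl

module _ {r : ℕ} (g m : ℕ) (b : Bool) (R : List Run) where
  private
    S = suc g + height R
  open TopRun S m b (toParts-below g R)
  open BottomRun (suc m) g b (toParts (conjugateRuns R))

  mes⇔repeating-top : 1 ≤ r → r ≤ m → ∀ {j k} → MesPair r π k j ⇔ RepeatingPair r μ j k
  mes⇔repeating-top 1≤r r≤m = mk⇔ to from
    where
    large : All (λ p → r < size p) π
    large = bottom-large (s≤s r≤m)
    top : IsLargestRepeating r μ S
    top = isLargestRepeating-top (s≤s z≤n) r≤m
    partsAbove-1 : partsAbove 1 π ≡ S
    partsAbove-1 = begin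
      partsAbove 1 π                             ≡⟨ partsAbove-all (All.map (≤-<-trans 1≤r) large) ⟩
      length π                                   ≡⟨ cong length (toParts-conjugateRuns-∷ g m b R) ⟨
      length (toParts (conjugateRuns ((g , m , b) ∷ R)))  ≡⟨ length-toParts (conjugateRuns ((g , m , b) ∷ R)) ⟩
      width (conjugateRuns ((g , m , b) ∷ R))    ≡⟨ width-conjugateRuns ((g , m , b) ∷ R) ⟩
      S                                          ∎
      where open ≡-Reasoning
    to : ∀ {j k} → MesPair r π k j → RepeatingPair r μ j k
    to (mes , refl) with isMes-unique mes (isMes-large large)
    ... | refl rewrite partsAbove-1 = top , partsAbove-top
    from : ∀ {j k} → RepeatingPair r μ j k → MesPair r π k j
    from (lr , refl) with isLargestRepeating-unique {xs = μ} lr top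
    ... | refl rewrite partsAbove-top = isMes-large large , partsAbove-1

  mes⇔repeating-below : m < r → (∀ {j k} → MesPair r (toParts (conjugateRuns R)) k j ⇔ RepeatingPair r (toParts R) j k) →
    ∀ {j k} → MesPair r π k j ⇔ RepeatingPair r μ j k
  mes⇔repeating-below m<r ih = mk⇔ to from
    where
    drop : ∀ {j} → IsLargestRepeating r μ j ⇔ IsLargestRepeating r (toParts R) j
    drop = isLargestRepeating-cong {xs = μ} {ys = toParts R} (isRepeating-drop-top m<r)
    below : ∀ {j} → IsLargestRepeating r (toParts R) j → j < S
    below (rep , _) = repeating-bounded (s≤s z≤n) (toParts-below g R) rep
    to : ∀ {j k} → MesPair r π k j → RepeatingPair r μ j k
    to (mes , refl) with isMes-bottom⁻ m<r mes
    ... | a , refl , mes′ with Equivalence.to ih (mes′ , sym (partsAbove-bottom (suc a)))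
    ... | lr′ , pa′ = Equivalence.from drop lr′ ,
                      trans (partsAbove-below (below lr′)) (trans (cong (suc m +_) pa′) (sym (+-suc m a)))
    from : ∀ {j k} → RepeatingPair r μ j k → MesPair r π k j
    from {j} (lr , refl) with Equivalence.from ih (Equivalence.to drop lr , refl)
    ... | mes′ , pa′ =
      subst (λ k → MesPair r π k j) (trans (+-suc m _) (sym (partsAbove-below (below (Equivalence.to drop lr)))))
            (isMes-bottom⁺ m<r mes′ , trans (partsAbove-bottom _) pa′)

mes⇔repeating : ∀ {r} → 1 ≤ r → ∀ R {j k} → MesPair r (toParts (conjugateRuns R)) k j ⇔ RepeatingPair r (toParts R) j k
mes⇔repeating 1≤r [] = mes⇔repeating-[]
mes⇔repeating {r} 1≤r ((g , m , b) ∷ R) rewrite toParts-conjugateRuns-∷ g m b R with m <? r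
... | yes m<r = mes⇔repeating-below g m b R m<r (mes⇔repeating 1≤r R)
... | no m≮r = mes⇔repeating-top g m b R 1≤r (≮⇒≥ m≮r)

conjugate-mes⇔repeating : ∀ {r μ j k} → 1 ≤ r → IsOverpartition μ → MesPair r (conjugate μ) k j ⇔ RepeatingPair r μ j k
conjugate-mes⇔repeating {r} {μ} {j} {k} 1≤r op =
  subst (λ ν → MesPair r (conjugate μ) k j ⇔ RepeatingPair r ν j k) (toParts-fromParts op) (mes⇔repeating 1≤r (fromParts μ))

-- The overpartition proof inside a refinement is irrelevant, so the equation it yields
-- has to be recomputed through decidable equality of lists.
conjugate-involutive-refined : ∀ {n} {P : List Part → Set} (x : [ π ∈ List Part ∣ IsOverpartitionOf n π × P π ]) →
  conjugate (conjugate (value x)) ≡ value x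
conjugate-involutive-refined (π , [ p ]) =
  recompute (≡-dec (Productₚ.≡-dec _≟_ Bool._≟_) (conjugate (conjugate π)) π) (conjugate-involutive (proj₁ (proj₁ p)))

theorem2p1 : (r : ℕ) → 1 ≤ r → (j k n : ℕ) → 1 ≤ k →
    ([ π ∈ List Part ∣ IsOverpartitionOf n π × IsMes r π k × partsAbove k π ≡ j ])
    ↔ ([ μ ∈ List Part ∣ IsOverpartitionOf n μ × IsLargestRepeating r μ j × partsAbove j μ ≡ k ∸ 1 ])
theorem2p1 r 1≤r j (suc k) n _ =
  mk↔ₛ′ (Refinement.map conjugate to) (Refinement.map conjugate from)
        (value-injective ∘ conjugate-involutive-refined) (value-injective ∘ conjugate-involutive-refined)
  where
  to : ∀ {π} → IsOverpartitionOf n π × MesPair r π k j → IsOverpartitionOf n (conjugate π) × RepeatingPair r (conjugate π) j k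
  to {π} (opn , mes) =
    conjugate-overpartitionOf opn ,
    Equivalence.to (conjugate-mes⇔repeating 1≤r (conjugate-isOverpartition π))
                   (subst (λ ν → MesPair r ν k j) (sym (conjugate-involutive (proj₁ opn))) mes)
  from : ∀ {μ} → IsOverpartitionOf n μ × RepeatingPair r μ j k → IsOverpartitionOf n (conjugate μ) × MesPair r (conjugate μ) k j
  from (opn , rep) = conjugate-overpartitionOf opn , Equivalence.from (conjugate-mes⇔repeating 1≤r (proj₁ opn)) rep
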